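{- Let $(U,\varphi)$ be a finite standard closure space in which the non-join-irreducible essential sets are pairwise incomparable under inclusion. Then the $E$-base of $(U,\varphi)$ is valid. If moreover the lattice of closed sets of $(U,\varphi)$ is atomistic, then the canonical base and the (aggregated) $E$-base of $(U,\varphi)$ are equal.
   Context: $(U,\varphi)$: finite set with closure operator; closed sets form a lattice under inclusion; standard: $\varphi(\{x\})\setminus\{x\}$ closed for all $x$. Join-irreducible closed set: one with exactly one predecessor. Atomistic: every join-irreducible closed set covers $\emptyset$. Quasi-closed $Q$: for all $X\subseteq Q$ with $\varphi(X)\subsetneq\varphi(Q)$, $\varphi(X)\subseteq Q$. Pseudo-closed $P$: not closed and inclusion-minimal among quasi-closed $Q$ with $\varphi(Q)=\varphi(P)$. Essential set: $\varphi(P)$ for $P$ pseudo-closed. Canonical base: $\{P\to\varphi(P)\setminus P: P \text{ pseudo-closed}\}$. $\varphi^b(X)=\bigcup_{y\in X}\varphi(\{y\})$. $D$-generator of $x$: $A$ with $x\in\varphi(A)$, $x\notin\varphi^b(A)$, and $x\notin\varphi(B)$ whenever $\varphi^b(B)\subsetneq\varphi^b(A)$. $E$-generator: $D$-generator $A$ of $x$ with $\varphi(A)$ inclusion-minimal among closures of $D$-generators of $x$. $E$-base: $\{a\to x: x\neq a, x\in\varphi(\{a\})\}\cup\{A\to x: A \text{ an } E\text{ -generator of } x\}$; aggregated form merges implications with equal premises. A set of implications induces the closure operator whose closed sets $C$ satisfy $A\subseteq C\Rightarrow X\subseteq C$ for all its $A\to X$; valid means this operator equals $\varphi$. -}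

module Defs where

open import Data.Nat using (ℕ)
open import Data.Fin using (Fin)
open import Data.Fin.Subset public
  using (Subset; _∈_; _∉_; _⊆_; _⊂_; ⁅_⁆; _─_; ⋃; ⊥)
open import Data.Bool using (if_then_else_)
open import Data.Vec using (lookup)
open import Data.List using (List; allFin; map)
open import Data.Product using (Σ; _×_; ∃; ∃-syntax; _,_)
open import Data.Sum using (_⊎_)
open import Relation.Nullary using (¬_)
open import Data.Empty renaming (⊥ to ⊥₀)
open import Relation.Binary.PropositionalEquality using (_≡_; _≢_)
open import Function.Bundles using (_⇔_)

record ClosureSpace (n : ℕ) : Set where
  field
    φ         : Subset n → Subset n
    extensive : ∀ X → X ⊆ φ X
    monotone  : ∀ {X Y} → X ⊆ Y → φ X ⊆ φ Y
    idempotent : ∀ X → φ (φ X) ≡ φ X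

-- An implication A → X, as a pair (premise , conclusion).
Imp : ℕ → Set
Imp n = Subset n × Subset n

ImpSet : ℕ → Set₁
ImpSet n = Imp n → Set

RespectsImps : ∀ {n} → ImpSet n → Subset n → Set
RespectsImps Σᵢ C = ∀ A X → Σᵢ (A , X) → A ⊆ C → X ⊆ C

module CS {n : ℕ} (S : ClosureSpace n) where
  open ClosureSpace S

  Closed : Subset n → Set
  Closed X = φ X ≡ X

  Standard : Set
  Standard = ∀ x → Closed (φ ⁅ x ⁆ ─ ⁅ x ⁆)

  LowerCover : Subset n → Subset n → Set
  LowerCover D C = Closed D × D ⊂ C
                 × (∀ E → Closed E → D ⊂ E → E ⊂ C → ⊥₀)

  JoinIrreducible : Subset n → Set
  JoinIrreducible C = Closed C × ∃[ D ] (LowerCover D C × (∀ D′ → LowerCover D′ C → D′ ≡ D))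

  Atomistic : Set
  Atomistic = ∀ C → JoinIrreducible C → LowerCover ⊥ C

  QuasiClosed : Subset n → Set
  QuasiClosed Q = ∀ X → X ⊆ Q → φ X ⊂ φ Q → φ X ⊆ Q

  PseudoClosed : Subset n → Set
  PseudoClosed P = ¬ Closed P × QuasiClosed P
                 × (∀ Q → QuasiClosed Q → φ Q ≡ φ P → Q ⊆ P → Q ≡ P)

  Essential : Subset n → Set
  Essential E = ∃[ P ] (PseudoClosed P × φ P ≡ E)

  CanonicalBase : ImpSet n
  CanonicalBase (A , X) = PseudoClosed A × X ≡ φ A ─ A

  φᵇ : Subset n → Subset n
  φᵇ X = ⋃ (map (λ y → if lookup X y then φ ⁅ y ⁆ else ⊥) (allFin n))

  DGenerator : Subset n → Fin n → Set
  DGenerator A x = x ∈ φ A × x ∉ φᵇ A × (∀ B → φᵇ B ⊂ φᵇ A → x ∉ φ B)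

  EGenerator : Subset n → Fin n → Set
  EGenerator A x = DGenerator A x
                 × (∀ B → DGenerator B x → φ B ⊆ φ A → φ B ≡ φ A)

  EBase : ImpSet n
  EBase (A , X) = (∃[ a ] ∃[ x ] (x ≢ a × x ∈ φ ⁅ a ⁆ × A ≡ ⁅ a ⁆ × X ≡ ⁅ x ⁆))
                ⊎ (∃[ x ] (EGenerator A x × X ≡ ⁅ x ⁆))

  AggregatedEBase : ImpSet n
  AggregatedEBase (A , Y) = (∃[ X ] EBase (A , X))
                          × (∀ z → (z ∈ Y) ⇔ (∃[ X ] (EBase (A , X) × z ∈ X)))

  -- The implication set Σ is valid: its induced closure operator equals φ,
  -- i.e. its closed sets are exactly the φ-closed sets.
  Valid : ImpSet n → Set
  Valid Σᵢ = ∀ C → Closed C ⇔ RespectsImps Σᵢ C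

  SameImps : ImpSet n → ImpSet n → Set
  SameImps Σ₁ Σ₂ = ∀ i → Σ₁ i ⇔ Σ₂ i

-- Choose a D-generator A ⊆ C of a point x ∉ C with φ A minimal.  Then
-- C ∩ φ A is quasi-closed but not closed, so φ A is essential; and φ A is not
-- join-irreducible, because a join-irreducible φ Y is the closure of a single
-- point of Y, which would put x in C.  The same construction with
-- C := {z ∣ x ∉ φ {z}} shows that below every D-generator B of x lies a
-- D-generator B′ of x with φ B′ ⊆ φ B essential and not join-irreducible.
-- Incomparability of these sets makes A an E-generator, so a set respecting
-- the E-base contains x, i.e. it is closed.  In a standard atomistic space
-- the singletons are closed, so φᵇ is the identity, no essential set is
-- join-irreducible, all essential sets are pairwise incomparable, and the
-- E-generators of x are exactly the pseudo-closed P with x ∈ φ P ∖ P.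
--
-- Membership in a subset of Fin n is decidable, so the minimal-counterexample
-- arguments run in the double-negation monad and are closed by decidable-stable.

module Submission where

open import Defs
open import Data.Nat using (ℕ)
open import Data.Product using (_×_)
open import Relation.Nullary using (¬_)
open import Relation.Binary.PropositionalEquality using (_≡_)

open import Level using (0ℓ)
open import Data.Bool using (true; false; if_then_else_)
import Data.Bool.Properties as Bool
open import Data.Empty using (⊥-elim) renaming (⊥ to ⊥₀)
open import Data.Fin using (Fin)
import Data.Fin as Fin
open import Data.Fin.Subset using (_∩_; Nonempty)
open import Data.Fin.Subset.Properties
  using (_∈?_; _⊆?_; _⊂?_; nonempty?; ⊆-refl; ⊆-trans; ⊆-antisym; ⊂-irref; ⊆-⊂-trans;
         ∉⊥; x∈⁅x⁆; x∈⁅y⁆⇒x≡y; x∈p∪q⁺; x∈p∪q⁻; x∈p∩q⁺; p∩q⊆p; p∩q⊆q;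
         x∈p∧x∉q⇒x∈p─q; p─q⊆p)
open import Data.Fin.Subset.Induction using (⊂-wellFounded; ⊃-wellFounded)
open import Data.List using (List; []; _∷_; allFin)
open import Data.List.Membership.Propositional using (lose)
open import Data.List.Membership.Propositional.Properties using (∈-allFin)
open import Data.List.Relation.Unary.Any using (Any; here; there; satisfied)
open import Data.List.Relation.Unary.Any.Properties using (map⁺; map⁻)
open import Data.Product using (∃; ∃-syntax; _,_; proj₁; proj₂)
open import Data.Sum using (inj₁; inj₂)
open import Data.Vec using (_∷_; here; there; lookup; tabulate)
open import Data.Vec.Properties using ([]=⇒lookup; lookup⇒[]=; lookup∘tabulate)
import Data.Vec.Properties as Vec
open import Effect.Monad using (RawMonad)
open import Function.Base using (_∘_)
open import Function.Bundles using (_⇔_; mk⇔; Equivalence)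
import Function.Properties.Equivalence as ⇔
open import Induction.WellFounded using (WellFounded; Acc; acc)
open import Relation.Binary.Core using (Rel)
import Relation.Binary.Construct.On as On
open import Relation.Binary.PropositionalEquality using (refl; sym; trans; subst; subst₂; _≢_)
open import Relation.Nullary using (yes; no; does)
open import Relation.Nullary.Decidable using (decidable-stable; dec-true; ¬?)
open import Relation.Nullary.Negation using (¬¬-Monad; ¬¬-map)
open import Relation.Unary using (Pred; Decidable)

open RawMonad (¬¬-Monad {0ℓ})

module _ {a r} {A : Set a} {_<_ : Rel A r} (wf : WellFounded _<_) where

  ¬¬-minimal : ∀ {p} {P : Pred A p} {x} → P x → ¬ ¬ ∃ λ y → P y × (∀ {z} → z < y → ¬ P z)
  ¬¬-minimal {P = P} = go (wf _)
    where
    go : ∀ {x} → Acc _<_ x → P x → ¬ ¬ ∃ λ y → P y × (∀ {z} → z < y → ¬ P z)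
    go (acc rs) px k = k (_ , px , λ z<x pz → go (rs z<x) pz k)

private
  variable
    n : ℕ

⁅⁆⊆ : ∀ {x} {p : Subset n} → x ∈ p → ⁅ x ⁆ ⊆ p
⁅⁆⊆ {x = x} x∈p y∈⁅x⁆ = subst (_∈ _) (sym (x∈⁅y⁆⇒x≡y x y∈⁅x⁆)) x∈p

x∈p─q⇒x∉q : ∀ {x} (p q : Subset n) → x ∈ p ─ q → x ∉ q
x∈p─q⇒x∉q (true  ∷ p) (false ∷ q) here      ()
x∈p─q⇒x∉q (_     ∷ p) (_     ∷ q) (there x∈p─q) (there x∈q) = x∈p─q⇒x∉q p q x∈p─q x∈q

⊈⇒¬¬∃ : {p q : Subset n} → ¬ p ⊆ q → ¬ ¬ (∃[ x ] (x ∈ p × x ∉ q))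
⊈⇒¬¬∃ {q = q} p⊈q k = p⊈q λ {x} x∈p → decidable-stable (x ∈? q) λ x∉q → k (x , x∈p , x∉q)

⊂⇒⊉ : {p q : Subset n} → p ⊂ q → ¬ q ⊆ p
⊂⇒⊉ (_ , x , x∈q , x∉p) q⊆p = x∉p (q⊆p x∈q)

⊆∧≢⇒⊂ : {p q : Subset n} → p ⊆ q → p ≢ q → p ⊂ q
⊆∧≢⇒⊂ {p = p} {q} p⊆q p≢q = decidable-stable (p ⊂? q) λ p⊄q →
  p≢q (⊆-antisym p⊆q λ {x} x∈q → decidable-stable (x ∈? p) λ x∉p → p⊄q (p⊆q , x , x∈q , x∉p))

⊆-stable : {p q : Subset n} → ¬ ¬ p ⊆ q → p ⊆ q
⊆-stable {p = p} {q} = decidable-stable (p ⊆? q)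

≡-stable : {p q : Subset n} → ¬ ¬ p ≡ q → p ≡ q
≡-stable {p = p} {q} = decidable-stable (Vec.≡-dec Bool._≟_ p q)

⟦_⟧ : {P : Pred (Fin n) 0ℓ} → Decidable P → Subset n
⟦ P? ⟧ = tabulate λ x → does (P? x)

∈⟦⟧⁺ : ∀ {P : Pred (Fin n) 0ℓ} (P? : Decidable P) {x} → P x → x ∈ ⟦ P? ⟧
∈⟦⟧⁺ P? {x = x} px = lookup⇒[]= x _ (trans (lookup∘tabulate _ x) (dec-true (P? x) px))

∈⟦⟧⁻ : ∀ {P : Pred (Fin n) 0ℓ} (P? : Decidable P) {x} → x ∈ ⟦ P? ⟧ → P x
∈⟦⟧⁻ P? {x = x} x∈ with P? x | trans (sym (lookup∘tabulate _ x)) ([]=⇒lookup x∈)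
... | yes px | _ = px


∈⋃⁺ : ∀ {x} (ps : List (Subset n)) → Any (x ∈_) ps → x ∈ ⋃ ps
∈⋃⁺ (p ∷ ps) (here x∈p)  = x∈p∪q⁺ (inj₁ x∈p)
∈⋃⁺ (p ∷ ps) (there x∈⋃) = x∈p∪q⁺ (inj₂ (∈⋃⁺ ps x∈⋃))

∈⋃⁻ : ∀ {x} (ps : List (Subset n)) → x ∈ ⋃ ps → Any (x ∈_) ps
∈⋃⁻ []       x∈⊥ = ⊥-elim (∉⊥ x∈⊥)
∈⋃⁻ (p ∷ ps) x∈  with x∈p∪q⁻ p (⋃ ps) x∈
... | inj₁ x∈p = here x∈p
... | inj₂ x∈⋃ = there (∈⋃⁻ ps x∈⋃)

⊆─⁅⁆ : ∀ {x} {p q : Subset n} → x ∉ q → q ⊆ p → q ⊆ p ─ ⁅ x ⁆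
⊆─⁅⁆ {x = x} {q = q} x∉q q⊆p y∈q =
  x∈p∧x∉q⇒x∈p─q (q⊆p y∈q) λ y∈⁅x⁆ → x∉q (subst (_∈ q) (x∈⁅y⁆⇒x≡y x y∈⁅x⁆) y∈q)

⇔⇒≡ : {p q : Subset n} → (∀ x → x ∈ p ⇔ x ∈ q) → p ≡ q
⇔⇒≡ p⇔q = ⊆-antisym (λ {x} → Equivalence.to (p⇔q x)) (λ {x} → Equivalence.from (p⇔q x))

∈-if⊥⁻ : ∀ b {p : Subset n} {x} → x ∈ (if b then p else ⊥) → b ≡ true × x ∈ p
∈-if⊥⁻ true  x∈p = refl , x∈p
∈-if⊥⁻ false x∈⊥ = ⊥-elim (∉⊥ x∈⊥)

Antichain : ∀ {ℓ} → Pred (Subset n) ℓ → Set ℓ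
Antichain 𝓔 = ∀ {E₁ E₂} → 𝓔 E₁ → 𝓔 E₂ → E₁ ⊆ E₂ → E₁ ≡ E₂

antichain-squeeze : ∀ {ℓ} {𝓔 : Pred (Subset n) ℓ} {E₁ E₂ E₃} → Antichain 𝓔
                  → 𝓔 E₁ → 𝓔 E₃ → E₁ ⊆ E₂ → E₂ ⊆ E₃ → E₂ ≡ E₃
antichain-squeeze {E₂ = E₂} antichain e₁ e₃ E₁⊆E₂ E₂⊆E₃ =
  ⊆-antisym E₂⊆E₃ (subst (_⊆ E₂) (antichain e₁ e₃ (⊆-trans E₁⊆E₂ E₂⊆E₃)) E₁⊆E₂)

module ClosureSpaceTheory {n : ℕ} (S : ClosureSpace n) where
  open ClosureSpace S
  open CS S

  φ-least : ∀ {X C} → Closed C → X ⊆ C → φ X ⊆ C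
  φ-least {X} closedC X⊆C = subst (φ X ⊆_) closedC (monotone X⊆C)

  φ⊆⇒closed : ∀ {X} → φ X ⊆ X → Closed X
  φ⊆⇒closed {X} φX⊆X = ⊆-antisym φX⊆X (extensive X)

  ∈φ∧∉⇒¬closed : ∀ {x X} → x ∈ φ X → x ∉ X → ¬ Closed X
  ∈φ∧∉⇒¬closed {x} x∈φX x∉X closedX = x∉X (subst (x ∈_) closedX x∈φX)

  x∈φ⁅x⁆ : ∀ x → x ∈ φ ⁅ x ⁆
  x∈φ⁅x⁆ x = extensive ⁅ x ⁆ (x∈⁅x⁆ x)

  φ⁅⁆⊆φ : ∀ {x X} → x ∈ φ X → φ ⁅ x ⁆ ⊆ φ X
  φ⁅⁆⊆φ {X = X} x∈φX = φ-least (idempotent X) (⁅⁆⊆ x∈φX)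

  φ-wellFounded : WellFounded (λ X Y → φ X ⊂ φ Y)
  φ-wellFounded = On.wellFounded φ ⊂-wellFounded

  φᵇ-wellFounded : WellFounded (λ X Y → φᵇ X ⊂ φᵇ Y)
  φᵇ-wellFounded = On.wellFounded φᵇ ⊂-wellFounded

  ∈φᵇ⁺ : ∀ {X x y} → y ∈ X → x ∈ φ ⁅ y ⁆ → x ∈ φᵇ X
  ∈φᵇ⁺ {X} {x} {y} y∈X x∈φy = ∈⋃⁺ _ (map⁺ (lose (∈-allFin y) x∈φᵇ-term))
    where
    x∈φᵇ-term : x ∈ (if lookup X y then φ ⁅ y ⁆ else ⊥)
    x∈φᵇ-term = subst (λ b → x ∈ (if b then φ ⁅ y ⁆ else ⊥)) (sym ([]=⇒lookup y∈X)) x∈φy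

  ∈φᵇ⁻ : ∀ {X x} → x ∈ φᵇ X → ∃[ y ] (y ∈ X × x ∈ φ ⁅ y ⁆)
  ∈φᵇ⁻ {X} x∈φᵇX with satisfied (map⁻ {xs = allFin n} (∈⋃⁻ _ x∈φᵇX))
  ... | y , x∈φᵇ-term with ∈-if⊥⁻ (lookup X y) x∈φᵇ-term
  ...   | lookup≡true , x∈φy = y , lookup⇒[]= y X lookup≡true , x∈φy

  X⊆φᵇX : ∀ X → X ⊆ φᵇ X
  X⊆φᵇX X {x} x∈X = ∈φᵇ⁺ x∈X (x∈φ⁅x⁆ x)

  φᵇ⊆φ : ∀ X → φᵇ X ⊆ φ X
  φᵇ⊆φ X x∈φᵇX with ∈φᵇ⁻ x∈φᵇX
  ... | y , y∈X , x∈φy = φ⁅⁆⊆φ (extensive X y∈X) x∈φy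

  φᵇ-mono : ∀ {X Y} → X ⊆ Y → φᵇ X ⊆ φᵇ Y
  φᵇ-mono X⊆Y x∈φᵇX with ∈φᵇ⁻ x∈φᵇX
  ... | y , y∈X , x∈φy = ∈φᵇ⁺ (X⊆Y y∈X) x∈φy

  φᵇ⊆⇒φ⊆ : ∀ {X Y} → φᵇ X ⊆ φᵇ Y → φ X ⊆ φ Y
  φᵇ⊆⇒φ⊆ {X} {Y} φᵇX⊆φᵇY = ⊆-trans (monotone (X⊆φᵇX X))
    (φ-least (idempotent Y) (⊆-trans φᵇX⊆φᵇY (φᵇ⊆φ Y)))

  DGenerator⇒∈φ─ : ∀ {A x} → DGenerator A x → x ∈ φ A ─ A
  DGenerator⇒∈φ─ {A} (x∈φA , x∉φᵇA , _) = x∈p∧x∉q⇒x∈p─q x∈φA (λ x∈A → x∉φᵇA (X⊆φᵇX A x∈A))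

  pseudoClosed-below : ∀ {Q} → QuasiClosed Q → ¬ Closed Q
                     → ¬ ¬ (∃[ P ] (PseudoClosed P × P ⊆ Q × φ P ≡ φ Q))
  pseudoClosed-below {Q} qQ ¬cQ =
    ¬¬-map minimal⇒pseudoClosed (¬¬-minimal ⊂-wellFounded {P = Candidate} (qQ , ¬cQ , ⊆-refl , refl))
    where
    Candidate : Subset n → Set
    Candidate P = QuasiClosed P × ¬ Closed P × P ⊆ Q × φ P ≡ φ Q

    minimal⇒pseudoClosed : (∃[ P ] (Candidate P × (∀ {R} → R ⊂ P → ¬ Candidate R)))
                         → ∃[ P ] (PseudoClosed P × P ⊆ Q × φ P ≡ φ Q)
    minimal⇒pseudoClosed (P , (qP , ¬cP , P⊆Q , φP≡φQ) , minimal) =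
      P , (¬cP , qP , minimalP) , P⊆Q , φP≡φQ
      where
      minimalP : ∀ R → QuasiClosed R → φ R ≡ φ P → R ⊆ P → R ≡ P
      minimalP R qR φR≡φP R⊆P = ≡-stable λ R≢P →
        minimal (⊆∧≢⇒⊂ R⊆P R≢P) (qR , ¬cR , ⊆-trans R⊆P P⊆Q , trans φR≡φP φP≡φQ)
        where
        ¬cR : ¬ Closed R
        ¬cR cR = ¬cP (φ⊆⇒closed (subst (_⊆ P) (trans (sym cR) φR≡φP) R⊆P))

  quasiClosed⇒essential : ∀ {Q} → QuasiClosed Q → ¬ Closed Q → ¬ ¬ Essential (φ Q)
  quasiClosed⇒essential qQ ¬cQ = ¬¬-map (λ (P , pc , _ , φP≡φQ) → P , pc , φP≡φQ) (pseudoClosed-below qQ ¬cQ)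

  ClosedBelow : Subset n → Subset n → Set
  ClosedBelow E K = ∀ {X} → X ⊆ K → φ X ⊂ E → φ X ⊆ K

  φ-∩φ : ∀ {K A} → A ⊆ K → φ (K ∩ φ A) ≡ φ A
  φ-∩φ {K} {A} A⊆K = ⊆-antisym (φ-least (idempotent A) (p∩q⊆q K (φ A)))
                               (monotone λ x∈A → x∈p∩q⁺ (A⊆K x∈A , extensive A x∈A))

  ∩φ-quasiClosed : ∀ {K A} → A ⊆ K → ClosedBelow (φ A) K → QuasiClosed (K ∩ φ A)
  ∩φ-quasiClosed {K} {A} A⊆K closedBelow X X⊆K∩φA φX⊂φK∩φA x∈φX =
    x∈p∩q⁺ (closedBelow (⊆-trans X⊆K∩φA (p∩q⊆p K (φ A))) φX⊂φA x∈φX , proj₁ φX⊂φA x∈φX)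
    where
    φX⊂φA : φ X ⊂ φ A
    φX⊂φA = subst (φ X ⊂_) (φ-∩φ A⊆K) φX⊂φK∩φA

  ∩φ-¬closed : ∀ {K A} → A ⊆ K → ¬ φ A ⊆ K → ¬ Closed (K ∩ φ A)
  ∩φ-¬closed {K} {A} A⊆K φA⊈K closed =
    φA⊈K (subst (_⊆ K) (trans (sym closed) (φ-∩φ A⊆K)) (p∩q⊆p K (φ A)))

  pseudoClosed-inside : ∀ {X} → ¬ Closed X → ¬ ¬ (∃[ P ] (PseudoClosed P × P ⊆ X))
  pseudoClosed-inside {X} ¬cX k =
    ¬¬-minimal φ-wellFounded {P = Escapes} (⊆-refl , λ φX⊆X → ¬cX (φ⊆⇒closed φX⊆X)) minimal⇒pseudoClosed
    where
    Escapes : Subset n → Set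
    Escapes Z = Z ⊆ X × ¬ φ Z ⊆ X

    minimal⇒pseudoClosed : ¬ (∃[ Z ] (Escapes Z × (∀ {Z′} → φ Z′ ⊂ φ Z → ¬ Escapes Z′)))
    minimal⇒pseudoClosed (Z , (Z⊆X , φZ⊈X) , minimal) =
      pseudoClosed-below (∩φ-quasiClosed Z⊆X closedBelow) (∩φ-¬closed Z⊆X φZ⊈X)
        λ (P , pc , P⊆X∩φZ , _) → k (P , pc , ⊆-trans P⊆X∩φZ (p∩q⊆p X (φ Z)))
      where
      closedBelow : ClosedBelow (φ Z) X
      closedBelow Z′⊆X φZ′⊂φZ = ⊆-stable λ φZ′⊈X → minimal φZ′⊂φZ (Z′⊆X , φZ′⊈X)

  lowerCover-above : ∀ {G F} → Closed G → G ⊂ F → ¬ ¬ (∃[ D ] (LowerCover D F × G ⊆ D))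
  lowerCover-above {G} {F} cG G⊂F =
    ¬¬-map maximal⇒lowerCover (¬¬-minimal ⊃-wellFounded {P = Between} (cG , ⊆-refl , G⊂F))
    where
    Between : Subset n → Set
    Between D = Closed D × G ⊆ D × D ⊂ F

    maximal⇒lowerCover : ∃[ D ] (Between D × (∀ {E} → D ⊂ E → ¬ Between E))
                       → ∃[ D ] (LowerCover D F × G ⊆ D)
    maximal⇒lowerCover (D , (cD , G⊆D , D⊂F) , maximal) =
      D , (cD , D⊂F , λ E cE D⊂E E⊂F → maximal D⊂E (cE , ⊆-trans G⊆D (proj₁ D⊂E) , E⊂F)) , G⊆D

  joinIrreducible-singleGenerator : ∀ {Y} → JoinIrreducible (φ Y)
                                  → ¬ ¬ (∃[ y ] (y ∈ Y × φ ⁅ y ⁆ ≡ φ Y))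
  joinIrreducible-singleGenerator {Y} (_ , D , (cD , D⊂φY , _) , unique) =
    ¬¬-map (λ (y , y∈Y , y∉D) → y , y∈Y , generates y∈Y y∉D)
           (⊈⇒¬¬∃ λ Y⊆D → ⊂⇒⊉ D⊂φY (φ-least cD Y⊆D))
    where
    generates : ∀ {y} → y ∈ Y → y ∉ D → φ ⁅ y ⁆ ≡ φ Y
    generates {y} y∈Y y∉D = ≡-stable λ φy≢φY →
      lowerCover-above (idempotent ⁅ y ⁆) (⊆∧≢⇒⊂ (φ⁅⁆⊆φ (extensive Y y∈Y)) φy≢φY)
        λ (D′ , lc , φy⊆D′) → y∉D (subst (y ∈_) (unique D′ lc) (φy⊆D′ (x∈φ⁅x⁆ y)))

  joinIrreducible⇒φ⊆φᵇ : ∀ {Y} → JoinIrreducible (φ Y) → φ Y ⊆ φᵇ Y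
  joinIrreducible⇒φ⊆φᵇ {Y} ji {x} x∈φY = decidable-stable (x ∈? φᵇ Y)
    (¬¬-map (λ (y , y∈Y , φy≡φY) → ∈φᵇ⁺ y∈Y (subst (x ∈_) (sym φy≡φY) x∈φY))
            (joinIrreducible-singleGenerator ji))

  DGenerator-below : ∀ {X x} → x ∈ φ X → x ∉ φᵇ X → ¬ ¬ (∃[ A ] (DGenerator A x × φᵇ A ⊆ φᵇ X))
  DGenerator-below {X} {x} x∈φX x∉φᵇX =
    ¬¬-map minimal⇒DGenerator (¬¬-minimal φᵇ-wellFounded {P = Generates} (x∈φX , x∉φᵇX , ⊆-refl))
    where
    Generates : Subset n → Set
    Generates A = x ∈ φ A × x ∉ φᵇ A × φᵇ A ⊆ φᵇ X

    minimal⇒DGenerator : ∃[ A ] (Generates A × (∀ {B} → φᵇ B ⊂ φᵇ A → ¬ Generates B))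
                       → ∃[ A ] (DGenerator A x × φᵇ A ⊆ φᵇ X)
    minimal⇒DGenerator (A , (x∈φA , x∉φᵇA , φᵇA⊆φᵇX) , minimal) =
      A , (x∈φA , x∉φᵇA , λ B φᵇB⊂φᵇA x∈φB →
             minimal φᵇB⊂φᵇA (x∈φB , x∉φᵇA ∘ proj₁ φᵇB⊂φᵇA , ⊆-trans (proj₁ φᵇB⊂φᵇA) φᵇA⊆φᵇX))
        , φᵇA⊆φᵇX

  NonJIEssential : Subset n → Set
  NonJIEssential E = Essential E × ¬ JoinIrreducible E

  ∩φ-nonJIEssential : ∀ {K A x} → A ⊆ K → ClosedBelow (φ A) K → x ∈ φ A → x ∉ φᵇ K
                    → ¬ ¬ NonJIEssential (φ A)
  ∩φ-nonJIEssential {K} {A} {x} A⊆K closedBelow x∈φA x∉φᵇK =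
    ¬¬-map (λ ess → subst Essential (φ-∩φ A⊆K) ess , ¬ji)
           (quasiClosed⇒essential (∩φ-quasiClosed A⊆K closedBelow) (∩φ-¬closed A⊆K φA⊈K))
    where
    φA⊈K : ¬ φ A ⊆ K
    φA⊈K φA⊆K = x∉φᵇK (X⊆φᵇX K (φA⊆K x∈φA))

    ¬ji : ¬ JoinIrreducible (φ A)
    ¬ji ji = x∉φᵇK (φᵇ-mono (p∩q⊆p K (φ A))
      (joinIrreducible⇒φ⊆φᵇ (subst JoinIrreducible (sym (φ-∩φ A⊆K)) ji)
                            (subst (x ∈_) (sym (φ-∩φ A⊆K)) x∈φA)))

  minimalDGenerator-nonJIEssential : ∀ {B x} → DGenerator B x → (∀ {A} → φ A ⊂ φ B → ¬ DGenerator A x)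
                                   → ¬ ¬ NonJIEssential (φ B)
  minimalDGenerator-nonJIEssential {B} {x} (x∈φB , x∉φᵇB , _) minimal =
    ∩φ-nonJIEssential B⊆K closedBelow x∈φB x∉φᵇK
    where
    x∉φ⁅_⁆? : Decidable (λ z → x ∉ φ ⁅ z ⁆)
    x∉φ⁅ z ⁆? = ¬? (x ∈? φ ⁅ z ⁆)

    K : Subset n
    K = ⟦ x∉φ⁅_⁆? ⟧

    B⊆K : B ⊆ K
    B⊆K b∈B = ∈⟦⟧⁺ x∉φ⁅_⁆? λ x∈φb → x∉φᵇB (∈φᵇ⁺ b∈B x∈φb)

    x∉φᵇK : x ∉ φᵇ K
    x∉φᵇK x∈φᵇK with ∈φᵇ⁻ x∈φᵇK
    ... | z , z∈K , x∈φz = ∈⟦⟧⁻ x∉φ⁅_⁆? z∈K x∈φz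

    closedBelow : ClosedBelow (φ B) K
    closedBelow {X} X⊆K φX⊂φB z∈φX = ∈⟦⟧⁺ x∉φ⁅_⁆? λ x∈φz →
      DGenerator-below (φ⁅⁆⊆φ z∈φX x∈φz) (x∉φᵇK ∘ φᵇ-mono X⊆K)
        λ (A , dgA , φᵇA⊆φᵇX) → minimal (⊆-⊂-trans (φᵇ⊆⇒φ⊆ φᵇA⊆φᵇX) φX⊂φB) dgA

  DGenerator-nonJIEssential-below : ∀ {B₀ x} → DGenerator B₀ x
    → ¬ ¬ (∃[ B ] (DGenerator B x × φ B ⊆ φ B₀ × NonJIEssential (φ B)))
  DGenerator-nonJIEssential-below {B₀} {x} dg₀ k =
    ¬¬-minimal φ-wellFounded {P = Below} (dg₀ , ⊆-refl) λ (B , (dgB , φB⊆φB₀) , minimal) →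
      minimalDGenerator-nonJIEssential dgB
        (λ φA⊂φB dgA → minimal φA⊂φB (dgA , ⊆-trans (proj₁ φA⊂φB) φB⊆φB₀))
        λ ess → k (B , dgB , φB⊆φB₀ , ess)
    where
    Below : Subset n → Set
    Below B = DGenerator B x × φ B ⊆ φ B₀

  EBase-sound : ∀ {A X} → EBase (A , X) → X ⊆ φ A
  EBase-sound (inj₁ (_ , _ , _ , x∈φa , refl , refl)) = ⁅⁆⊆ x∈φa
  EBase-sound (inj₂ (_ , ((x∈φA , _) , _) , refl))   = ⁅⁆⊆ x∈φA

  closed⇒respects : ∀ {Σᵢ : ImpSet n} {C} → (∀ {A X} → Σᵢ (A , X) → X ⊆ φ A)
                  → Closed C → RespectsImps Σᵢ C
  closed⇒respects sound cC A X A→X A⊆C = ⊆-trans (sound A→X) (φ-least cC A⊆C)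

  module Respecting (antichain : Antichain NonJIEssential) {C} (respects : RespectsImps EBase C) where

    φᵇ-respected : φᵇ C ⊆ C
    φᵇ-respected {x} x∈φᵇC with ∈φᵇ⁻ x∈φᵇC
    ... | y , y∈C , x∈φy with x Fin.≟ y
    ...   | yes refl = y∈C
    ...   | no  x≢y  = respects ⁅ y ⁆ ⁅ x ⁆ (inj₁ (y , x , x≢y , x∈φy , refl , refl)) (⁅⁆⊆ y∈C) (x∈⁅x⁆ x)

    EGenerator-respected : ∀ {A x} → EGenerator A x → A ⊆ C → x ∈ C
    EGenerator-respected {A} {x} eg A⊆C = respects A ⁅ x ⁆ (inj₂ (x , eg , refl)) A⊆C (x∈⁅x⁆ x)

    Escaping : Subset n → Set
    Escaping A = ∃[ x ] (x ∉ C × A ⊆ C × DGenerator A x)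

    minimalEscaping⇒EGenerator : ∀ {A x} → x ∉ C → A ⊆ C → DGenerator A x
                               → (∀ {A′} → φ A′ ⊂ φ A → ¬ Escaping A′) → EGenerator A x
    minimalEscaping⇒EGenerator {A} {x} x∉C A⊆C dg@(x∈φA , _) minimal = dg , E-minimal
      where
      closedBelow : ClosedBelow (φ A) C
      closedBelow {X} X⊆C φX⊂φA {z} z∈φX = decidable-stable (z ∈? C) λ z∉C →
        DGenerator-below z∈φX (z∉C ∘ φᵇ-respected ∘ φᵇ-mono X⊆C) λ (A′ , dg′ , φᵇA′⊆φᵇX) →
          minimal (⊆-⊂-trans (φᵇ⊆⇒φ⊆ φᵇA′⊆φᵇX) φX⊂φA)
                  (z , z∉C , φᵇ-respected ∘ φᵇ-mono X⊆C ∘ φᵇA′⊆φᵇX ∘ X⊆φᵇX A′ , dg′)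

      E-minimal : ∀ B → DGenerator B x → φ B ⊆ φ A → φ B ≡ φ A
      E-minimal B dgB φB⊆φA = ≡-stable do
        essA ← ∩φ-nonJIEssential A⊆C closedBelow x∈φA (x∉C ∘ φᵇ-respected)
        (B′ , _ , φB′⊆φB , essB′) ← DGenerator-nonJIEssential-below dgB
        pure (antichain-squeeze antichain essB′ essA φB′⊆φB φB⊆φA)

    DGenerator-respected : ∀ {A x} → A ⊆ C → DGenerator A x → x ∈ C
    DGenerator-respected {A} {x} A⊆C dg = decidable-stable (x ∈? C) λ x∉C →
      ¬¬-minimal φ-wellFounded {P = Escaping} (x , x∉C , A⊆C , dg)
        λ (A′ , (x′ , x′∉C , A′⊆C , dg′) , minimal) →
          x′∉C (EGenerator-respected (minimalEscaping⇒EGenerator x′∉C A′⊆C dg′ minimal) A′⊆C)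

    respects⇒closed : Closed C
    respects⇒closed = φ⊆⇒closed λ {x} x∈φC → decidable-stable (x ∈? C) λ x∉C →
      DGenerator-below x∈φC (x∉C ∘ φᵇ-respected) λ (A , dg , φᵇA⊆φᵇC) →
        x∉C (DGenerator-respected (φᵇ-respected ∘ φᵇA⊆φᵇC ∘ X⊆φᵇX A) dg)

  EBase-valid : Antichain NonJIEssential → Valid EBase
  EBase-valid antichain C = mk⇔ (closed⇒respects EBase-sound) (Respecting.respects⇒closed antichain)

  EGenerator⇒essential : ∀ {A x} → EGenerator A x → ¬ ¬ Essential (φ A)
  EGenerator⇒essential (dg , E-minimal) = ¬¬-map
    (λ (B , dgB , φB⊆φA , essB , _) → subst Essential (E-minimal B dgB φB⊆φA) essB)
    (DGenerator-nonJIEssential-below dg)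

  closed-below-essential : Antichain Essential → ∀ {E X} → Essential E → φ X ⊂ E → Closed X
  closed-below-essential antichain essE φX⊂E = ≡-stable λ ¬cX →
    pseudoClosed-inside ¬cX λ (P , pc , P⊆X) →
      ⊂-irref (antichain-squeeze antichain (P , pc , refl) essE (monotone P⊆X) (proj₁ φX⊂E)) φX⊂E

  essential⇒quasiClosed : Antichain Essential → ∀ {B} → Essential (φ B) → QuasiClosed B
  essential⇒quasiClosed antichain {B} essB X X⊆B φX⊂φB =
    subst (_⊆ B) (sym (closed-below-essential antichain essB φX⊂φB)) X⊆B

  closed∋⇒¬⊂φ⁅⁆ : ∀ {X a} → Closed X → a ∈ X → ¬ X ⊂ φ ⁅ a ⁆
  closed∋⇒¬⊂φ⁅⁆ cX a∈X X⊂φa = ⊂⇒⊉ X⊂φa (φ-least cX (⁅⁆⊆ a∈X))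

  module _ (standard : Standard) (a : Fin n) where

    φ⁅⁆-lowerCover : LowerCover (φ ⁅ a ⁆ ─ ⁅ a ⁆) (φ ⁅ a ⁆)
    φ⁅⁆-lowerCover = standard a , (p─q⊆p _ _ , a , x∈φ⁅x⁆ a , a∉) , noBetween
      where
      a∉ : a ∉ φ ⁅ a ⁆ ─ ⁅ a ⁆
      a∉ a∈ = x∈p─q⇒x∉q _ _ a∈ (x∈⁅x⁆ a)

      noBetween : ∀ E → Closed E → φ ⁅ a ⁆ ─ ⁅ a ⁆ ⊂ E → E ⊂ φ ⁅ a ⁆ → ⊥₀
      noBetween E cE D⊂E E⊂φa with a ∈? E
      ... | yes a∈E = closed∋⇒¬⊂φ⁅⁆ cE a∈E E⊂φa
      ... | no  a∉E = ⊂⇒⊉ D⊂E (⊆─⁅⁆ a∉E (proj₁ E⊂φa))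

    φ⁅⁆-lowerCover-unique : ∀ D → LowerCover D (φ ⁅ a ⁆) → D ≡ φ ⁅ a ⁆ ─ ⁅ a ⁆
    φ⁅⁆-lowerCover-unique D (cD , D⊂φa , noBetween) = ≡-stable λ D≢ →
      noBetween _ (standard a) (⊆∧≢⇒⊂ D⊆ D≢) (proj₁ (proj₂ φ⁅⁆-lowerCover))
      where
      D⊆ : D ⊆ φ ⁅ a ⁆ ─ ⁅ a ⁆
      D⊆ = ⊆─⁅⁆ (λ a∈D → closed∋⇒¬⊂φ⁅⁆ cD a∈D D⊂φa) (proj₁ D⊂φa)

    φ⁅⁆-joinIrreducible : JoinIrreducible (φ ⁅ a ⁆)
    φ⁅⁆-joinIrreducible = idempotent ⁅ a ⁆ , _ , φ⁅⁆-lowerCover , φ⁅⁆-lowerCover-unique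

  standard∧atomistic⇒singletonClosed : Standard → Atomistic → ∀ a → Closed ⁅ a ⁆
  standard∧atomistic⇒singletonClosed standard atomistic a = ⊆-antisym φa⊆a (extensive ⁅ a ⁆)
    where
    ⊥≡ : ⊥ ≡ φ ⁅ a ⁆ ─ ⁅ a ⁆
    ⊥≡ = φ⁅⁆-lowerCover-unique standard a ⊥ (atomistic _ (φ⁅⁆-joinIrreducible standard a))

    φa⊆a : φ ⁅ a ⁆ ⊆ ⁅ a ⁆
    φa⊆a {z} z∈φa = decidable-stable (z ∈? ⁅ a ⁆) λ z∉a →
      ∉⊥ (subst (z ∈_) (sym ⊥≡) (x∈p∧x∉q⇒x∈p─q z∈φa z∉a))

  module SingletonsClosed (singletonClosed : ∀ a → Closed ⁅ a ⁆) (antichain : Antichain NonJIEssential) where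

    φᵇ-id : ∀ X → φᵇ X ≡ X
    φᵇ-id X = ⊆-antisym φᵇX⊆X (X⊆φᵇX X)
      where
      φᵇX⊆X : φᵇ X ⊆ X
      φᵇX⊆X x∈φᵇX with ∈φᵇ⁻ x∈φᵇX
      ... | y , y∈X , x∈φy = ⁅⁆⊆ y∈X (subst (_ ∈_) (singletonClosed y) x∈φy)

    essential⇒¬joinIrreducible : ∀ {E} → Essential E → ¬ JoinIrreducible E
    essential⇒¬joinIrreducible (P , (¬cP , _) , refl) ji =
      ¬cP (φ⊆⇒closed (subst (φ P ⊆_) (φᵇ-id P) (joinIrreducible⇒φ⊆φᵇ ji)))

    essentials-antichain : Antichain Essential
    essentials-antichain e₁ e₂ =
      antichain (e₁ , essential⇒¬joinIrreducible e₁) (e₂ , essential⇒¬joinIrreducible e₂)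

    pseudoClosed⇒EGenerator : ∀ {A x} → PseudoClosed A → x ∈ φ A → x ∉ A → EGenerator A x
    pseudoClosed⇒EGenerator {A} {x} pc@(_ , qA , minA) x∈φA x∉A =
      (x∈φA , subst (x ∉_) (sym (φᵇ-id A)) x∉A , D-minimal) , E-minimal
      where
      D-minimal : ∀ B → φᵇ B ⊂ φᵇ A → x ∉ φ B
      D-minimal B φᵇB⊂φᵇA x∈φB = x∉A (qA B B⊆A (⊆∧≢⇒⊂ (monotone B⊆A) φB≢φA) x∈φB)
        where
        B⊂A : B ⊂ A
        B⊂A = subst₂ _⊂_ (φᵇ-id B) (φᵇ-id A) φᵇB⊂φᵇA
        B⊆A = proj₁ B⊂A

        φB≢φA : φ B ≢ φ A
        φB≢φA φB≡φA = ⊂-irref (minA B qB φB≡φA B⊆A) B⊂A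
          where
          qB = essential⇒quasiClosed essentials-antichain (A , pc , sym φB≡φA)

      E-minimal : ∀ B → DGenerator B x → φ B ⊆ φ A → φ B ≡ φ A
      E-minimal B dgB φB⊆φA = ≡-stable (¬¬-map
        (λ (B′ , _ , φB′⊆φB , essB′ , _) →
          antichain-squeeze essentials-antichain essB′ (A , pc , refl) φB′⊆φB φB⊆φA)
        (DGenerator-nonJIEssential-below dgB))

    EGenerator⇒pseudoClosed : ∀ {A x} → EGenerator A x → PseudoClosed A
    EGenerator⇒pseudoClosed {A} {x} eg@((x∈φA , x∉φᵇA , D-minimal) , _) = ¬cA , qA , minA
      where
      ¬cA : ¬ Closed A
      ¬cA = ∈φ∧∉⇒¬closed x∈φA (x∉φᵇA ∘ X⊆φᵇX A)

      qA : QuasiClosed A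
      qA X X⊆A φX⊂φA {z} z∈φX = decidable-stable (z ∈? A) (¬¬-map
        (λ essA → essential⇒quasiClosed essentials-antichain essA X X⊆A φX⊂φA z∈φX)
        (EGenerator⇒essential eg))

      minA : ∀ Q → QuasiClosed Q → φ Q ≡ φ A → Q ⊆ A → Q ≡ A
      minA Q _ φQ≡φA Q⊆A = ≡-stable λ Q≢A →
        D-minimal Q (subst₂ _⊂_ (sym (φᵇ-id Q)) (sym (φᵇ-id A)) (⊆∧≢⇒⊂ Q⊆A Q≢A))
                    (subst (x ∈_) (sym φQ≡φA) x∈φA)

    EBase⇒EGenerator : ∀ {A X} → EBase (A , X) → ∃[ x ] (EGenerator A x × X ≡ ⁅ x ⁆)
    EBase⇒EGenerator (inj₁ (a , x , x≢a , x∈φa , _)) =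
      ⊥-elim (x≢a (x∈⁅y⁆⇒x≡y a (subst (x ∈_) (singletonClosed a) x∈φa)))
    EBase⇒EGenerator (inj₂ eg) = eg

    EBase-conclusions : ∀ {A} → PseudoClosed A → ∀ z → (z ∈ φ A ─ A) ⇔ (∃[ X ] (EBase (A , X) × z ∈ X))
    EBase-conclusions {A} pc z = mk⇔ to from
      where
      to : z ∈ φ A ─ A → ∃[ X ] (EBase (A , X) × z ∈ X)
      to z∈ = ⁅ z ⁆ , inj₂ (z , pseudoClosed⇒EGenerator pc (p─q⊆p _ _ z∈) (x∈p─q⇒x∉q _ _ z∈) , refl)
                    , x∈⁅x⁆ z

      from : ∃[ X ] (EBase (A , X) × z ∈ X) → z ∈ φ A ─ A
      from (X , A→X , z∈X) with EBase⇒EGenerator A→X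
      ... | x , (dg , _) , refl = subst (_∈ φ A ─ A) (sym (x∈⁅y⁆⇒x≡y x z∈X)) (DGenerator⇒∈φ─ dg)

    pseudoClosed-EBasePremise : ∀ {A} → PseudoClosed A → ∃[ X ] EBase (A , X)
    pseudoClosed-EBasePremise {A} pc@(¬cA , _) with decidable-stable (nonempty? (φ A ─ A)) new
      where
      new : ¬ ¬ Nonempty (φ A ─ A)
      new empty = ¬cA (φ⊆⇒closed λ {z} z∈φA → decidable-stable (z ∈? A) λ z∉A →
        empty (z , x∈p∧x∉q⇒x∈p─q z∈φA z∉A))
    ... | z , z∈ with Equivalence.to (EBase-conclusions pc z) z∈
    ...   | X , A→X , _ = X , A→X

    canonicalBase≡aggregatedEBase : SameImps CanonicalBase AggregatedEBase
    canonicalBase≡aggregatedEBase (A , Y) = mk⇔ to from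
      where
      to : CanonicalBase (A , Y) → AggregatedEBase (A , Y)
      to (pc , refl) = pseudoClosed-EBasePremise pc , EBase-conclusions pc

      from : AggregatedEBase (A , Y) → CanonicalBase (A , Y)
      from ((X , A→X) , conclusions) with EBase⇒EGenerator A→X
      ... | _ , eg , _ = pc , ⇔⇒≡ λ z → ⇔.trans (conclusions z) (⇔.sym (EBase-conclusions pc z))
        where
        pc = EGenerator⇒pseudoClosed eg

corollary4 : ∀ {n : ℕ} (S : ClosureSpace n) → CS.Standard S
    → (∀ E₁ E₂ → CS.Essential S E₁ → CS.Essential S E₂
         → ¬ (CS.JoinIrreducible S E₁) → ¬ (CS.JoinIrreducible S E₂)
         → E₁ ⊆ E₂ → E₁ ≡ E₂)
    → CS.Valid S (CS.EBase S)
      × (CS.Atomistic S → CS.SameImps S (CS.CanonicalBase S) (CS.AggregatedEBase S))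
corollary4 S standard incomparable =
  EBase-valid antichain ,
  λ atomistic → SingletonsClosed.canonicalBase≡aggregatedEBase
                  (standard∧atomistic⇒singletonClosed standard atomistic) antichain
  where
  open ClosureSpaceTheory S

  antichain : Antichain NonJIEssential
  antichain (ess₁ , ¬ji₁) (ess₂ , ¬ji₂) = incomparable _ _ ess₁ ess₂ ¬ji₁ ¬ji₂
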